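{- Let $\pi$ be a permutation of $[n]$ whose left-to-right maxima, listed in increasing order of value, are $m_1<m_2<\dots<m_j$, and suppose every left-to-right maximum of $\pi$ initiates a descent. Set $m_0=0$. Then $\pi$ avoids the barred pattern $\overline{3}\overline{1}542$ if and only if, for each $i=1,\dots,j$, the entries of $\pi$ that are not left-to-right maxima and whose values lie strictly between $m_{i-1}$ and $m_i$ appear in $\pi$ in increasing order (from left to right).
   Context: A permutation $\pi=\pi(1)\cdots\pi(n)$ of $[n]$ avoids the barred pattern $\overline{3}\overline{1}542$ if for all indices $a<b<c$ with $\pi(a)>\pi(b)>\pi(c)$ there exist indices $d<e<a$ with $\pi(e)<\pi(c)<\pi(d)<\pi(b)$. An entry $\pi(i)$ is a left-to-right maximum if $\pi(i)>\pi(h)$ for all $h<i$; it initiates a descent if $i<n$ and $\pi(i)>\pi(i+1)$. (In the paper's language: in the permutation diagram, the set of non-left-to-right-maximum entries with values between $m_{i-1}$ and $m_i$ is the $i$-th horizontal strip, and the condition says the bullets in each horizontal strip are rising.) -}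

module Defs where

open import Data.Nat using (ℕ; suc)
open import Data.Fin using (Fin; toℕ; _<_; _>_)
open import Data.Fin.Permutation using (Permutation′; _⟨$⟩ʳ_)
open import Data.Product using (Σ; _×_; ∃-syntax)
open import Relation.Nullary using (¬_)
open import Relation.Binary.PropositionalEquality using (_≡_)

-- A permutation of [n] is represented as a bijection Fin n ↔ Fin n;
-- position i (0-based) holds value π ⟨$⟩ʳ i (0-based).  Shifting all
-- positions and values by 1 preserves every order relation used below.

IsLRMax : ∀ {n} → Permutation′ n → Fin n → Set
IsLRMax π i = ∀ h → h < i → π ⟨$⟩ʳ h < π ⟨$⟩ʳ i

InitiatesDescent : ∀ {n} → Permutation′ n → Fin n → Set
InitiatesDescent {n} π i =
  Σ (Fin n) λ j → (toℕ j ≡ suc (toℕ i)) × (π ⟨$⟩ʳ j < π ⟨$⟩ʳ i)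

Avoids31542 : ∀ {n} → Permutation′ n → Set
Avoids31542 π =
  ∀ a b c → a < b → b < c →
    π ⟨$⟩ʳ a > π ⟨$⟩ʳ b → π ⟨$⟩ʳ b > π ⟨$⟩ʳ c →
    ∃[ d ] ∃[ e ] (d < e × e < a ×
      π ⟨$⟩ʳ e < π ⟨$⟩ʳ c × π ⟨$⟩ʳ c < π ⟨$⟩ʳ d × π ⟨$⟩ʳ d < π ⟨$⟩ʳ b)

-- value v lies strictly between m_{i-1} and m_i, where m_i = π(k) is a
-- left-to-right maximum and m_{i-1} is the largest left-to-right maximum
-- value below m_i (or m_0 = 0 if there is none): i.e. v < m_i and every
-- left-to-right maximum value smaller than m_i is smaller than v.
InStrip : ∀ {n} → Permutation′ n → Fin n → Fin n → Set
InStrip π k v =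
  v < π ⟨$⟩ʳ k × (∀ h → IsLRMax π h → π ⟨$⟩ʳ h < π ⟨$⟩ʳ k → π ⟨$⟩ʳ h < v)

StripsRising : ∀ {n} → Permutation′ n → Set
StripsRising π =
  ∀ k → IsLRMax π k →
  ∀ p q → p < q → ¬ IsLRMax π p → ¬ IsLRMax π q →
    InStrip π k (π ⟨$⟩ʳ p) → InStrip π k (π ⟨$⟩ʳ q) →
    π ⟨$⟩ʳ p < π ⟨$⟩ʳ q

module Submission where

-- Every entry is weakly dominated by a left-to-right maximum at or before its
-- position, so everything left of a maximum m_i lies below its strip. Hence
-- strip entries lie right of m_i, and a descent b > c inside a strip, with
-- a := m_i, would need the witnesses d < e of 3̄1̄ left of m_i with
-- π(c) < π(d): impossible. Conversely, for an occurrence a b c of 542 let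
-- m_i = π(k) be the first entry exceeding π(c); its strip contains π(c), so
-- rising strips force π(k) < π(b), and the descent π(k) > π(k+1) gives the
-- witnesses d = k, e = k + 1, with π(k+1) < π(c) again by rising strips.

open import Data.Empty using (⊥-elim)
open import Data.Fin using (Fin; toℕ; _<_; _≤_)
open import Data.Fin.Induction using (<-wellFounded)
open import Data.Fin.Permutation using (Permutation′; _⟨$⟩ʳ_)
open import Data.Fin.Properties using (any?; <-cmp; ≤∧≢⇒<; <⇒≢) renaming (_<?_ to _<ᶠ?_)
open import Data.Nat as ℕ using (ℕ; suc)
import Data.Nat.Properties as ℕ
open import Data.Product using (_×_; _,_; ∃-syntax; proj₁)
open import Function.Base using (_∘_)
open import Function.Bundles using (_⇔_; mk⇔; Injection)
open import Function.Properties.Inverse using (↔⇒↣)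
open import Induction.WellFounded using (Acc; acc)
open import Relation.Binary.Definitions using (tri<; tri≈; tri>)
open import Relation.Binary.PropositionalEquality using (_≡_; _≢_; refl; sym; subst)
open import Relation.Nullary using (¬_; yes; no)
open import Relation.Nullary.Decidable using (_×-dec_)
open import Relation.Unary using (Pred; Decidable)

open import Defs

leftmost : ∀ {n p} {P : Pred (Fin n) p} → Decidable P →
           ∀ {x} → P x → ∃[ h ] h ≤ x × P h × (∀ g → g < h → ¬ P g)
leftmost {P = P} P? {x} px = go x (<-wellFounded x) px
  where
  go : ∀ x → Acc _<_ x → P x → ∃[ h ] h ≤ x × P h × (∀ g → g < h → ¬ P g)
  go x (acc rec) px with any? (λ g → (g <ᶠ? x) ×-dec P? g)
  ... | yes (g , g<x , pg) =
    let h , h≤g , ph , first = go g (rec g<x) pg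
    in h , ℕ.≤-trans h≤g (ℕ.<⇒≤ g<x) , ph , first
  ... | no none = x , ℕ.≤-refl , px , λ g g<x pg → none (g , g<x , pg)

module _ {n : ℕ} (π : Permutation′ n) where

  ⟨$⟩ʳ-injective : ∀ {i j} → π ⟨$⟩ʳ i ≡ π ⟨$⟩ʳ j → i ≡ j
  ⟨$⟩ʳ-injective = Injection.injective (↔⇒↣ π)

  ⟨$⟩ʳ-<-if-≯ : ∀ {i j} → i ≢ j → ¬ π ⟨$⟩ʳ j < π ⟨$⟩ʳ i → π ⟨$⟩ʳ i < π ⟨$⟩ʳ j
  ⟨$⟩ʳ-<-if-≯ i≢j j≮i = ≤∧≢⇒< (ℕ.≮⇒≥ j≮i) (i≢j ∘ ⟨$⟩ʳ-injective)

  ¬IsLRMax-after-larger : ∀ {a b} → a < b → π ⟨$⟩ʳ b < π ⟨$⟩ʳ a → ¬ IsLRMax π b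
  ¬IsLRMax-after-larger a<b πb<πa lrmax-b = ℕ.<-asym πb<πa (lrmax-b _ a<b)

  -- A threshold t : ℕ covers both v ≤ π(h) (t = toℕ v) and v < π(h) (t = suc (toℕ v)).
  leftmost-reaching : ∀ t {x} → t ℕ.≤ toℕ (π ⟨$⟩ʳ x) →
    ∃[ h ] h ≤ x × t ℕ.≤ toℕ (π ⟨$⟩ʳ h) × IsLRMax π h ×
           (∀ g → g < h → toℕ (π ⟨$⟩ʳ g) ℕ.< t)
  leftmost-reaching t reaches-x =
    let h , h≤x , reaches-h , first = leftmost (λ g → t ℕ.≤? toℕ (π ⟨$⟩ʳ g)) reaches-x
        earlier-below g g<h = ℕ.≰⇒> (first g g<h)
    in h , h≤x , reaches-h , (λ g g<h → ℕ.<-≤-trans (earlier-below g g<h) reaches-h) , earlier-below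

  dominating-LRMax : ∀ x → ∃[ h ] h ≤ x × π ⟨$⟩ʳ x ≤ π ⟨$⟩ʳ h × IsLRMax π h
  dominating-LRMax x =
    let h , h≤x , πx≤πh , lrmax-h , _ = leftmost-reaching (toℕ (π ⟨$⟩ʳ x)) ℕ.≤-refl
    in h , h≤x , πx≤πh , lrmax-h

  left-of-LRMax-below-strip : ∀ {k v x} → IsLRMax π k → InStrip π k v → x < k → π ⟨$⟩ʳ x < v
  left-of-LRMax-below-strip {x = x} lrmax-k (_ , above-smaller-LRMax) x<k =
    let h , h≤x , πx≤πh , lrmax-h = dominating-LRMax x
    in ℕ.≤-<-trans πx≤πh (above-smaller-LRMax h lrmax-h (lrmax-k h (ℕ.≤-<-trans h≤x x<k)))

  strip-right-of-LRMax : ∀ {k x} → IsLRMax π k → InStrip π k (π ⟨$⟩ʳ x) → k < x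
  strip-right-of-LRMax lrmax-k x∈k@(πx<πk , _) =
    ≤∧≢⇒< (ℕ.≮⇒≥ (ℕ.<-irrefl refl ∘ left-of-LRMax-below-strip lrmax-k x∈k))
          (λ { refl → ℕ.<-irrefl refl πx<πk })

  strip-of-LRMax : ∀ {k} {u v : Fin n} → IsLRMax π k → (∀ h → h < k → π ⟨$⟩ʳ h < u) →
                   u ≤ v → v < π ⟨$⟩ʳ k → InStrip π k v
  strip-of-LRMax {k} {v = v} lrmax-k left-below u≤v v<πk = v<πk , above-smaller-LRMax
    where
    above-smaller-LRMax : ∀ h → IsLRMax π h → π ⟨$⟩ʳ h < π ⟨$⟩ʳ k → π ⟨$⟩ʳ h < v
    above-smaller-LRMax h lrmax-h πh<πk with <-cmp h k
    ... | tri< h<k _ _ = ℕ.<-≤-trans (left-below h h<k) u≤v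
    ... | tri≈ _ refl _ = ⊥-elim (ℕ.<-irrefl refl πh<πk)
    ... | tri> _ _ k<h = ⊥-elim (ℕ.<-asym πh<πk (lrmax-h k k<h))

  avoids⇒stripsRising : Avoids31542 π → StripsRising π
  avoids⇒stripsRising avoids k lrmax-k p q p<q _ _ p∈k q∈k =
    ⟨$⟩ʳ-<-if-≯ (<⇒≢ p<q) πq≮πp
    where
    πq≮πp : ¬ π ⟨$⟩ʳ q < π ⟨$⟩ʳ p
    πq≮πp πq<πp =
      let d , e , d<e , e<k , _ , πq<πd , _ =
            avoids k p q (strip-right-of-LRMax lrmax-k p∈k) p<q (proj₁ p∈k) πq<πp
      in ℕ.<-asym πq<πd (left-of-LRMax-below-strip lrmax-k q∈k (ℕ.<-trans d<e e<k))

  stripsRising⇒avoids : (∀ i → IsLRMax π i → InitiatesDescent π i) →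
                        StripsRising π → Avoids31542 π
  stripsRising⇒avoids descent rising a b c a<b b<c πb<πa πc<πb
    with leftmost-reaching (suc (toℕ (π ⟨$⟩ʳ c))) (ℕ.<-trans πc<πb πb<πa)
  ... | k , k≤a , πc<πk , lrmax-k , earlier-≤πc with descent k lrmax-k
  ... | j , j≡k+1 , πj<πk = k , j , k<j , j<a , πj<πc , πc<πk , πk<πb
    where
    a<c : a < c
    a<c = ℕ.<-trans a<b b<c

    earlier-below : ∀ h → h < k → π ⟨$⟩ʳ h < π ⟨$⟩ʳ c
    earlier-below h h<k =
      ≤∧≢⇒< (ℕ.≤-pred (earlier-≤πc h h<k))
            (<⇒≢ (ℕ.<-≤-trans h<k (ℕ.<⇒≤ (ℕ.≤-<-trans k≤a a<c))) ∘ ⟨$⟩ʳ-injective)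

    in-strip : ∀ {v} → π ⟨$⟩ʳ c ≤ v → v < π ⟨$⟩ʳ k → InStrip π k v
    in-strip = strip-of-LRMax lrmax-k earlier-below

    strip-entry-before-c-below-c : ∀ x → x < c → ¬ IsLRMax π x →
      π ⟨$⟩ʳ x < π ⟨$⟩ʳ k → π ⟨$⟩ʳ x < π ⟨$⟩ʳ c
    strip-entry-before-c-below-c x x<c ¬lrmax-x πx<πk =
      ⟨$⟩ʳ-<-if-≯ (<⇒≢ x<c) λ πc<πx →
        ℕ.<-asym πc<πx
          (rising k lrmax-k x c x<c ¬lrmax-x
             (¬IsLRMax-after-larger a<c (ℕ.<-trans πc<πb πb<πa))
             (in-strip (ℕ.<⇒≤ πc<πx) πx<πk) (in-strip ℕ.≤-refl πc<πk))

    πk<πb : π ⟨$⟩ʳ k < π ⟨$⟩ʳ b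
    πk<πb = ⟨$⟩ʳ-<-if-≯ (<⇒≢ (ℕ.≤-<-trans k≤a a<b)) λ πb<πk →
      ℕ.<-asym πc<πb
        (strip-entry-before-c-below-c b b<c (¬IsLRMax-after-larger a<b πb<πa) πb<πk)

    k<a : k < a
    k<a = ≤∧≢⇒< k≤a λ { refl → ℕ.<-asym πk<πb πb<πa }

    k<j : k < j
    k<j = ℕ.≤-reflexive (sym j≡k+1)

    j<a : j < a
    j<a = ≤∧≢⇒< (subst (ℕ._≤ toℕ a) (sym j≡k+1) k<a)
                λ { refl → ℕ.<-asym πj<πk (ℕ.<-trans πk<πb πb<πa) }

    πj<πc : π ⟨$⟩ʳ j < π ⟨$⟩ʳ c
    πj<πc = strip-entry-before-c-below-c j (ℕ.<-trans j<a a<c)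
              (¬IsLRMax-after-larger k<j πj<πk) πj<πk

proposition3 : (n : ℕ) (π : Permutation′ n) →
    (∀ i → IsLRMax π i → InitiatesDescent π i) →
    (Avoids31542 π ⇔ StripsRising π)
proposition3 n π descent =
  mk⇔ (avoids⇒stripsRising π) (stripsRising⇒avoids π descent)
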